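{- Every finite simple graph $G$ is embeddable on at most $\chi(G)$ columns, i.e. $G$ has a grid drawing in $\mathbb{Z}^2$ all of whose vertex images lie in the union of at most $\chi(G)$ columns.
   Context: A column of $\mathbb{Z}^2$ with rank $x_1\in\mathbb{Z}$ is the set $\{(x_1,x):x\in\mathbb{Z}\}$. A grid drawing of $G=(V,E)$ in $\mathbb{Z}^2$ is an injective map $\phi\colon V\to\mathbb{Z}^2$ such that for every edge $uv\in E$ and vertex $w\in V$, if $\phi(w)$ lies on the closed segment $\overline{\phi(u)\phi(v)}$ then $w\in\{u,v\}$. $G$ is embeddable (can be drawn) on $l$ columns if it has a grid drawing in $\mathbb{Z}^2$ whose vertex images all lie in the union of $l$ columns. $\chi(G)$ is the chromatic number. -}

module Defs where

open import Data.Nat using (ℕ; _≤_)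
open import Data.Fin using (Fin)
open import Data.Integer using (ℤ; _-_; _*_) renaming (_≤_ to _≤ℤ_)
open import Data.Integer.Base using (_⊓_; _⊔_)
open import Data.Product using (_×_; _,_; proj₁; proj₂; ∃; Σ)
open import Data.List using (List; length)
open import Data.List.Membership.Propositional using (_∈_)
open import Relation.Binary.PropositionalEquality using (_≡_)
open import Relation.Nullary using (¬_)
open import Function.Definitions using (Injective)
open import Data.Sum using (_⊎_)

record Graph (n : ℕ) : Set₁ where
  field
    Adj   : Fin n → Fin n → Set
    sym   : ∀ {u v} → Adj u v → Adj v u
    irrefl : ∀ {u} → ¬ Adj u u

open Graph public

IsColouring : ∀ {n} → Graph n → (k : ℕ) → (Fin n → Fin k) → Set
IsColouring G k c = ∀ {u v} → Adj G u v → ¬ (c u ≡ c v)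

Colourable : ∀ {n} → Graph n → ℕ → Set
Colourable {n} G k = Σ (Fin n → Fin k) (IsColouring G k)

IsChromaticNumber : ∀ {n} → Graph n → ℕ → Set
IsChromaticNumber G k = Colourable G k × (∀ j → Colourable G j → k ≤ j)

Point : Set
Point = ℤ × ℤ

-- p lies on the closed segment between a and b (lattice points).
OnSegment : Point → Point → Point → Set
OnSegment (ax , ay) (bx , by) (px , py) =
  ((bx - ax) * (py - ay) ≡ (by - ay) * (px - ax)) ×
  ((ax ⊓ bx) ≤ℤ px) × (px ≤ℤ (ax ⊔ bx)) ×
  ((ay ⊓ by) ≤ℤ py) × (py ≤ℤ (ay ⊔ by))

IsGridDrawing : ∀ {n} → Graph n → (Fin n → Point) → Set
IsGridDrawing {n} G φ =
  Injective _≡_ _≡_ φ ×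
  (∀ u v w → Adj G u v → OnSegment (φ u) (φ v) (φ w) → (w ≡ u) ⊎ (w ≡ v))

DrawableOnColumns : ∀ {n} → Graph n → ℕ → Set
DrawableOnColumns {n} G l =
  Σ (Fin n → Point) λ φ → IsGridDrawing G φ ×
    Σ (List ℤ) λ cols → (length cols ≤ l) × (∀ v → proj₁ (φ v) ∈ cols)

-- Place vertex v at (c(v), B^v), where c is a proper k-colouring and B = k + 2, so that
-- the columns are the colour classes and B exceeds every colour.  If w lay on an edge uv,
-- then c(u) ≠ c(v) and, with e = c(w) − c(u) and f = c(v) − c(w) (say c(u) < c(v)),
-- collinearity reads (e + f)·B^w = e·B^v + f·B^u with 0 < e + f < B.  Comparing
-- base-B expansions, this forces w = u or w = v.
module Submission where

open import Defs
open import Data.Nat using (ℕ)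

open import Data.Nat
  using (suc; _+_; _*_; _∸_; _^_; _≤_; _<_; s≤s; z≤n; z<s; NonZero; >-nonZero)
import Data.Nat.Properties as ℕₚ
open import Data.Fin using (Fin; toℕ)
open import Data.Fin.Properties using (toℕ-injective; toℕ<n)
open import Data.Integer as ℤ using (ℤ; +_; +≤+; _-_)
import Data.Integer.Properties as ℤₚ
open import Data.Integer.Tactic.RingSolver using (solve-∀)
open import Data.Product using (_,_; proj₂)
open import Data.Sum using (_⊎_; inj₁; inj₂) renaming (map to ⊎-map; swap to ⊎-swap)
open import Data.Empty using (⊥-elim)
open import Data.List using (List; length; map; allFin)
open import Data.List.Properties using (length-map; length-tabulate)
open import Data.List.Membership.Propositional.Properties using (∈-map⁺; ∈-allFin)
open import Function using (_∘_)
open import Function.Definitions using (Injective)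
open import Relation.Binary.Definitions using (tri<; tri≈; tri>)
open import Relation.Binary.PropositionalEquality as ≡
  using (_≡_; _≢_; refl; trans; cong; cong₂; subst; module ≡-Reasoning)

m*b^i<n*b^j : ∀ {b m n i j} → m < b → 0 < n → i < j → m * b ^ i < n * b ^ j
m*b^i<n*b^j {b} {m} {n} {i} {j} m<b 0<n i<j = begin-strict
  m * b ^ i     <⟨ ℕₚ.*-monoˡ-< (b ^ i) {{b^i≢0}} m<b ⟩
  b ^ suc i     ≤⟨ ℕₚ.^-monoʳ-≤ b {{b≢0}} i<j ⟩
  b ^ j         ≤⟨ ℕₚ.m≤n*m (b ^ j) n {{>-nonZero 0<n}} ⟩
  n * b ^ j     ∎
  where
  open ℕₚ.≤-Reasoning
  b≢0 : NonZero b
  b≢0 = >-nonZero (ℕₚ.m<n⇒0<n m<b)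
  b^i≢0 : NonZero (b ^ i)
  b^i≢0 = >-nonZero (ℕₚ.m^n>0 b {{b≢0}} i)

^-injectiveʳ : ∀ {b i j} → 1 < b → b ^ i ≡ b ^ j → i ≡ j
^-injectiveʳ {b} {i} {j} 1<b eq with ℕₚ.<-cmp i j
... | tri< i<j _ _ = ⊥-elim (ℕₚ.<-irrefl eq (ℕₚ.^-monoʳ-< b 1<b i<j))
... | tri≈ _ i≡j _ = i≡j
... | tri> _ _ i>j = ⊥-elim (ℕₚ.<-irrefl (≡.sym eq) (ℕₚ.^-monoʳ-< b 1<b i>j))

weighted-mean-of-powers : ∀ {b} e f {i j k} → 0 < e + f → e + f < b →
  (e + f) * b ^ k ≡ e * b ^ j + f * b ^ i → k ≡ i ⊎ k ≡ j
weighted-mean-of-powers {b} 0 f {i} {j} {k} 0<e+f e+f<b eq =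
  inj₁ (^-injectiveʳ 1<b (ℕₚ.*-cancelˡ-≡ (b ^ k) (b ^ i) f {{>-nonZero 0<e+f}} eq))
  where
  1<b : 1 < b
  1<b = ℕₚ.≤-<-trans 0<e+f e+f<b
weighted-mean-of-powers {b} e@(suc _) 0 {i} {j} {k} 0<e e<b eq =
  inj₂ (^-injectiveʳ 1<b (ℕₚ.*-cancelˡ-≡ (b ^ k) (b ^ j) e eq′))
  where
  1<b : 1 < b
  1<b = ℕₚ.≤-<-trans 0<e e<b
  eq′ : e * b ^ k ≡ e * b ^ j
  eq′ = trans (cong (_* b ^ k) (≡.sym (ℕₚ.+-identityʳ e)))
              (trans eq (ℕₚ.+-identityʳ (e * b ^ j)))
weighted-mean-of-powers {b} e@(suc _) f@(suc _) {i} {j} {k} 0<e+f e+f<b eq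
  with ℕₚ.<-cmp k i | ℕₚ.<-cmp k j
... | tri≈ _ k≡i _ | _ = inj₁ k≡i
... | _ | tri≈ _ k≡j _ = inj₂ k≡j
... | tri< k<i _ _ | _ = ⊥-elim (ℕₚ.<-irrefl eq (ℕₚ.<-≤-trans
      (m*b^i<n*b^j {n = f} e+f<b z<s k<i) (ℕₚ.m≤n+m (f * b ^ i) (e * b ^ j))))
... | _ | tri< k<j _ _ = ⊥-elim (ℕₚ.<-irrefl eq (ℕₚ.<-≤-trans
      (m*b^i<n*b^j {n = e} e+f<b z<s k<j) (ℕₚ.m≤m+n (e * b ^ j) (f * b ^ i))))
... | tri> _ _ k>i | tri> _ _ k>j = ⊥-elim (ℕₚ.<-irrefl (≡.sym eq) (begin-strict
      e * b ^ j + f * b ^ i  <⟨ ℕₚ.+-mono-< (ℕₚ.*-monoʳ-< e (b^-mono k>j))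
                                           (ℕₚ.*-monoʳ-< f (b^-mono k>i)) ⟩
      e * b ^ k + f * b ^ k  ≡⟨ ℕₚ.*-distribʳ-+ (b ^ k) e f ⟨
      (e + f) * b ^ k        ∎))
  where
  open ℕₚ.≤-Reasoning
  b^-mono : ∀ {m n} → m < n → b ^ m < b ^ n
  b^-mono = ℕₚ.^-monoʳ-< b (ℕₚ.≤-<-trans 0<e+f e+f<b)

+-cancel-difference : ∀ {p q} r → p ≡ q → r ℤ.+ (q - p) ≡ r
+-cancel-difference {p} r refl = trans (cong (λ t → r ℤ.+ t) (ℤₚ.+-inverseʳ p)) (ℤₚ.+-identityʳ r)

pos-∸ : ∀ {m n} → m ≤ n → + (n ∸ m) ≡ + n - + m
pos-∸ {m} {n} m≤n = ≡.sym (trans (ℤₚ.m-n≡m⊖n n m) (ℤₚ.⊖-≥ m≤n))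

collinear⇒cross-section : ∀ xa xb xw ya yb yw →
  (xb - xa) ℤ.* (yw - ya) ≡ (yb - ya) ℤ.* (xw - xa) →
  (xb - xa) ℤ.* yw ≡ (xw - xa) ℤ.* yb ℤ.+ (xb - xw) ℤ.* ya
collinear⇒cross-section xa xb xw ya yb yw collinear = begin
  (xb - xa) ℤ.* yw                                     ≡⟨ identity xa xb xw ya yb yw ⟩
  (xw - xa) ℤ.* yb ℤ.+ (xb - xw) ℤ.* ya ℤ.+ (P - Q)   ≡⟨ +-cancel-difference _ (≡.sym collinear) ⟩
  (xw - xa) ℤ.* yb ℤ.+ (xb - xw) ℤ.* ya               ∎
  where
  open ≡-Reasoning
  P Q : ℤ
  P = (xb - xa) ℤ.* (yw - ya)
  Q = (yb - ya) ℤ.* (xw - xa)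
  identity : ∀ xa xb xw ya yb yw → (xb - xa) ℤ.* yw ≡
    (xw - xa) ℤ.* yb ℤ.+ (xb - xw) ℤ.* ya ℤ.+ ((xb - xa) ℤ.* (yw - ya) - (yb - ya) ℤ.* (xw - xa))
  identity = solve-∀

onSegment-sym : ∀ p q r → OnSegment p q r → OnSegment q p r
onSegment-sym (ax , ay) (bx , by) (rx , ry) (collinear , ax⊓bx≤rx , rx≤ax⊔bx , ay⊓by≤ry , ry≤ay⊔by) =
  trans (identity ax ay bx by rx ry) (+-cancel-difference _ collinear) ,
  subst (ℤ._≤ rx) (ℤₚ.⊓-comm ax bx) ax⊓bx≤rx ,
  subst (rx ℤ.≤_) (ℤₚ.⊔-comm ax bx) rx≤ax⊔bx ,
  subst (ℤ._≤ ry) (ℤₚ.⊓-comm ay by) ay⊓by≤ry ,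
  subst (ry ℤ.≤_) (ℤₚ.⊔-comm ay by) ry≤ay⊔by
  where
  identity : ∀ ax ay bx by rx ry → (ax - bx) ℤ.* (ry - by) ≡
    (ay - by) ℤ.* (rx - bx) ℤ.+ ((by - ay) ℤ.* (rx - ax) - (bx - ax) ℤ.* (ry - ay))
  identity = solve-∀

powerPoint : ℕ → ℕ → ℕ → Point
powerPoint b x i = + x , + (b ^ i)

onSegment-powerPoint-< : ∀ {b xi xj xk i j k} → xi < xj → xj < b →
  OnSegment (powerPoint b xi i) (powerPoint b xj j) (powerPoint b xk k) → k ≡ i ⊎ k ≡ j
onSegment-powerPoint-< {b} {xi} {xj} {xk} {i} {j} {k} xi<xj xj<b
  (collinear , +≤+ xi⊓xj≤xk , +≤+ xk≤xi⊔xj , _) =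
  weighted-mean-of-powers e f 0<e+f e+f<b weighted
  where
  xi≤xk : xi ≤ xk
  xi≤xk = subst (_≤ xk) (ℕₚ.m≤n⇒m⊓n≡m (ℕₚ.<⇒≤ xi<xj)) xi⊓xj≤xk
  xk≤xj : xk ≤ xj
  xk≤xj = subst (xk ≤_) (ℕₚ.m≤n⇒m⊔n≡n (ℕₚ.<⇒≤ xi<xj)) xk≤xi⊔xj
  e f : ℕ
  e = xk ∸ xi
  f = xj ∸ xk
  e+f≡xj∸xi : e + f ≡ xj ∸ xi
  e+f≡xj∸xi = begin
    e + f             ≡⟨ ℕₚ.+-comm e f ⟩
    f + e             ≡⟨ ℕₚ.+-∸-assoc f xi≤xk ⟨
    (f + xk) ∸ xi     ≡⟨ cong (_∸ xi) (ℕₚ.m∸n+n≡m xk≤xj) ⟩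
    xj ∸ xi           ∎
    where open ≡-Reasoning
  0<e+f : 0 < e + f
  0<e+f = subst (0 <_) (≡.sym e+f≡xj∸xi) (ℕₚ.m<n⇒0<n∸m xi<xj)
  e+f<b : e + f < b
  e+f<b = ℕₚ.≤-<-trans (subst (_≤ xj) (≡.sym e+f≡xj∸xi) (ℕₚ.m∸n≤m xj xi)) xj<b
  weighted : (e + f) * b ^ k ≡ e * b ^ j + f * b ^ i
  weighted = ℤₚ.+-injective (begin
    + ((e + f) * b ^ k)                                   ≡⟨ ℤₚ.pos-* (e + f) (b ^ k) ⟩
    + (e + f) ℤ.* + b ^ k                                 ≡⟨ cong (ℤ._* + b ^ k)
                                                               (trans (cong +_ e+f≡xj∸xi) (pos-∸ (ℕₚ.<⇒≤ xi<xj))) ⟩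
    (+ xj - + xi) ℤ.* + b ^ k                             ≡⟨ collinear⇒cross-section (+ xi) (+ xj) (+ xk) (+ b ^ i) (+ b ^ j) (+ b ^ k) collinear ⟩
    (+ xk - + xi) ℤ.* + b ^ j ℤ.+ (+ xj - + xk) ℤ.* + b ^ i ≡⟨ cong₂ (λ p q → p ℤ.* + b ^ j ℤ.+ q ℤ.* + b ^ i)
                                                               (pos-∸ xi≤xk) (pos-∸ xk≤xj) ⟨
    + e ℤ.* + b ^ j ℤ.+ + f ℤ.* + b ^ i                   ≡⟨ cong₂ ℤ._+_ (ℤₚ.pos-* e (b ^ j)) (ℤₚ.pos-* f (b ^ i)) ⟨
    + (e * b ^ j) ℤ.+ + (f * b ^ i)                       ≡⟨ ℤₚ.pos-+ (e * b ^ j) (f * b ^ i) ⟨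
    + (e * b ^ j + f * b ^ i)                             ∎)
    where open ≡-Reasoning

onSegment-powerPoint : ∀ {b xi xj xk i j k} → xi ≢ xj → xi < b → xj < b →
  OnSegment (powerPoint b xi i) (powerPoint b xj j) (powerPoint b xk k) → k ≡ i ⊎ k ≡ j
onSegment-powerPoint {xi = xi} {xj} xi≢xj xi<b xj<b onSegment with ℕₚ.<-cmp xi xj
... | tri< xi<xj _ _ = onSegment-powerPoint-< xi<xj xj<b onSegment
... | tri≈ _ xi≡xj _ = ⊥-elim (xi≢xj xi≡xj)
... | tri> _ _ xi>xj = ⊎-swap (onSegment-powerPoint-< xi>xj xi<b (onSegment-sym _ _ _ onSegment))

powerDrawing : ∀ {n k} → (Fin n → Fin k) → Fin n → Point
powerDrawing {k = k} c v = powerPoint (2 + k) (toℕ (c v)) (toℕ v)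

powerDrawing-injective : ∀ {n k} (c : Fin n → Fin k) → Injective _≡_ _≡_ (powerDrawing c)
powerDrawing-injective c eq =
  toℕ-injective (^-injectiveʳ (s≤s (s≤s z≤n)) (ℤₚ.+-injective (cong proj₂ eq)))

powerDrawing-isGridDrawing : ∀ {n k} (G : Graph n) {c : Fin n → Fin k} →
  IsColouring G k c → IsGridDrawing G (powerDrawing c)
powerDrawing-isGridDrawing {k = k} G {c} proper =
  powerDrawing-injective c ,
  λ u v w uv onSegment → ⊎-map toℕ-injective toℕ-injective
    (onSegment-powerPoint (proper uv ∘ toℕ-injective) (colour<base u) (colour<base v) onSegment)
  where
  colour<base : ∀ v → toℕ (c v) < 2 + k
  colour<base v = ℕₚ.<-≤-trans (toℕ<n (c v)) (ℕₚ.m≤n+m k 2)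

colourColumns : ℕ → List ℤ
colourColumns k = map (+_ ∘ toℕ) (allFin k)

length-colourColumns : ∀ k → length (colourColumns k) ≡ k
length-colourColumns k = trans (length-map (+_ ∘ toℕ) (allFin k)) (length-tabulate (λ i → i))

colourable⇒drawableOnColumns : ∀ {n} (G : Graph n) k → Colourable G k → DrawableOnColumns G k
colourable⇒drawableOnColumns G k (c , proper) =
  powerDrawing c , powerDrawing-isGridDrawing G proper ,
  colourColumns k , ℕₚ.≤-reflexive (length-colourColumns k) ,
  λ v → ∈-map⁺ (+_ ∘ toℕ) (∈-allFin (c v))

mainTheorem5 : ∀ {n} (G : Graph n) (k : ℕ) → IsChromaticNumber G k →
    DrawableOnColumns G k
mainTheorem5 G k (colourable , _) = colourable⇒drawableOnColumns G k colourable
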